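{- For every finite simple undirected graph $G=(V,E)$: $\mathrm{RTD}(\mathcal{C}_{star}(G)) \le \mathrm{VCD}(\mathcal{C}_{star}(G))$.
   Context: $N_G^o(x)=\{y:\{x,y\}\in E\}$. The concept class $\mathcal{C}_{star}(G)$ over domain $V$ is $\{X\cup\{x\} : x\in V,\ X\subseteq N_G^o(x)\}$. $\mathrm{VCD}$ is the Vapnik–Chervonenkis dimension (largest $S\subseteq V$ such that every $S'\subseteq S$ equals $S\cap C$ for some concept $C$). For a finite concept class $\mathcal{C}$ over a finite domain $\mathcal{X}$, a teaching set for $C\in\mathcal{C}$ is a set $D\subseteq\mathcal{X}$ such that for every $C'\in\mathcal{C}\setminus\{C\}$ there is $x\in D$ with ($x\in C\iff x\notin C'$); $\mathrm{TD}(C,\mathcal{C})$ is the minimum size of such a set, $\mathrm{TD}_{min}(\mathcal{C})=\min_{C}\mathrm{TD}(C,\mathcal{C})$, $\mathcal{C}_{min}=\{C:\mathrm{TD}(C,\mathcal{C})=\mathrm{TD}_{min}(\mathcal{C})\}$, and $\mathrm{RTD}(\mathcal{C})=\mathrm{TD}_{min}(\mathcal{C})$ if $\mathcal{C}=\mathcal{C}_{min}$, otherwise $\mathrm{RTD}(\mathcal{C})=\max\{\mathrm{TD}_{min}(\mathcal{C}),\mathrm{RTD}(\mathcal{C}\setminus\mathcal{C}_{min})\}$. -}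

module Defs where

open import Data.Bool using (Bool; true; false; not; _∧_; _∨_; if_then_else_)
open import Data.Nat using (ℕ; zero; suc; _⊔_; _⊓_; _^_; _+_)
open import Data.Fin using (Fin)
open import Data.Fin.Properties using () renaming (_≟_ to _≟ᶠ_)
open import Data.Fin.Subset using (Subset; _∩_; ∣_∣)
open import Data.List using (List; []; _∷_; _++_; map; filter; foldr; allFin)
open import Data.Bool.ListAction using (all; any)
open import Data.Vec using (Vec; []; _∷_; lookup)
open import Data.Vec.Properties using (≡-dec)
import Data.Bool.Properties as BoolP
open import Relation.Binary.PropositionalEquality using (_≡_)
open import Relation.Nullary.Decidable using (⌊_⌋; ¬?)

record SimpleGraph (n : ℕ) : Set where
  field
    adj    : Fin n → Fin n → Bool
    sym    : ∀ x y → adj x y ≡ adj y x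
    irrefl : ∀ x → adj x x ≡ false
open SimpleGraph public

Class : ℕ → Set
Class n = Subset n → Bool

allSubsets : (n : ℕ) → List (Subset n)
allSubsets zero    = [] ∷ []
allSubsets (suc n) = map (true ∷_) (allSubsets n) ++ map (false ∷_) (allSubsets n)

members : ∀ {n} → Class n → List (Subset n)
members {n} 𝒞 = filter (λ C → 𝒞 C BoolP.≟ true) (allSubsets n)

_==ˢ_ : ∀ {n} → Subset n → Subset n → Bool
C ==ˢ C′ = ⌊ ≡-dec BoolP._≟_ C C′ ⌋

_==ᵇ_ : Bool → Bool → Bool
a ==ᵇ b = ⌊ a BoolP.≟ b ⌋

-- minimum / maximum of a list of naturals (empty list ↦ 0)
minList : List ℕ → ℕ
minList []       = 0
minList (x ∷ xs) = foldr _⊓_ x xs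

maxList : List ℕ → ℕ
maxList = foldr _⊔_ 0

-- The star concept class C_star(G) = { X ∪ {x} : x ∈ V, X ⊆ N°_G(x) }.
-- S belongs to it iff there is x ∈ S with every y ∈ S, y ≠ x, adjacent to x.

Cstar : ∀ {n} → SimpleGraph n → Class n
Cstar {n} G S =
  any (λ x → lookup S x ∧
             all (λ y → not (lookup S y) ∨ ⌊ y ≟ᶠ x ⌋ ∨ adj G x y) (allFin n))
      (allFin n)

IsTeachingSet : ∀ {n} → Class n → Subset n → Subset n → Bool
IsTeachingSet {n} 𝒞 C D =
  all (λ C′ → C′ ==ˢ C ∨
              any (λ x → lookup D x ∧ not (lookup C x ==ᵇ lookup C′ x)) (allFin n))
      (members 𝒞)

-- TD(C, 𝒞) = minimum size of a teaching set.  (The full domain is always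
-- a teaching set, so the candidate list is nonempty.)
TD : ∀ {n} → Class n → Subset n → ℕ
TD {n} 𝒞 C =
  minList (map ∣_∣ (filter (λ D → IsTeachingSet 𝒞 C D BoolP.≟ true) (allSubsets n)))

-- TD_min(𝒞) = min over C ∈ 𝒞 of TD(C, 𝒞)   (0 for the empty class)
TDmin : ∀ {n} → Class n → ℕ
TDmin 𝒞 = minList (map (TD 𝒞) (members 𝒞))

Cmin : ∀ {n} → Class n → Class n
Cmin 𝒞 C = 𝒞 C ∧ ⌊ TD 𝒞 C Data.Nat.≟ TDmin 𝒞 ⌋

removeMin : ∀ {n} → Class n → Class n
removeMin 𝒞 C = 𝒞 C ∧ not (Cmin 𝒞 C)

-- The paper's recursion
--   RTD(𝒞) = TD_min(𝒞)                          if 𝒞 = 𝒞_min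
--          = max (TD_min(𝒞), RTD(𝒞 ∖ 𝒞_min))    otherwise
-- strictly shrinks the (finite) class, so it is computed with fuel;
-- 2^n + 1 steps always suffice (a class over Fin n has ≤ 2^n members).

rtdFuel : ∀ {n} → ℕ → Class n → ℕ
rtdFuel zero    𝒞 = 0
rtdFuel (suc f) 𝒞 =
  if all (λ C → Cmin 𝒞 C) (members 𝒞)
  then TDmin 𝒞
  else TDmin 𝒞 ⊔ rtdFuel f (removeMin 𝒞)

RTD : ∀ {n} → Class n → ℕ
RTD {n} 𝒞 = rtdFuel (2 ^ n + 1) 𝒞

IsShattered : ∀ {n} → Class n → Subset n → Bool
IsShattered {n} 𝒞 S =
  all (λ S′ → not (S′ ⊆ᵇ S) ∨ any (λ C → (S ∩ C) ==ˢ S′) (members 𝒞))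
      (allSubsets n)
  where
  _⊆ᵇ_ : Subset n → Subset n → Bool
  A ⊆ᵇ B = all (λ x → not (lookup A x) ∨ lookup B x) (allFin n)

VCD : ∀ {n} → Class n → ℕ
VCD {n} 𝒞 =
  maxList (map ∣_∣ (filter (λ S → IsShattered 𝒞 S BoolP.≟ true) (allSubsets n)))

-- Write d = VCD (C_star G).  Every open neighbourhood N(x) is shattered, the subset
-- X ⊆ N(x) being cut out by the star X ∪ {x}; hence |N(x)| ≤ d.  RTD is bounded by the
-- largest TD_min of a subclass, so it suffices to show TD_min 𝒞 ≤ d for every nonempty
-- 𝒞 ⊆ C_star G.  If the largest concept of 𝒞 has at most d elements, it teaches itself.
-- Otherwise let C ∈ 𝒞 have more than d elements and let R be its non-centres.  As C is not
-- shattered, a centre x of any star containing R is a centre of C (a centre outside C would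
-- be adjacent to all of R and C would be shattered), and a star with the same centre x as C
-- lies inside C (otherwise C ⊊ N(x) ∪ {x} and |C| ≤ d).  So if M is a smallest concept of 𝒞
-- containing R and x is a centre of M, then C − x teaches M: a concept of 𝒞 agreeing with M
-- on C − x contains R, hence lies inside C, hence is M or M − x, and M − x is too small.

{-# OPTIONS --safe #-}
module Submission where

open import Defs hiding (sym)
open import Data.Bool using (Bool; true; false; T; not; _∧_; _∨_)
open import Data.Bool.Properties using (T-≡; T-∧) renaming (_≟_ to _≟ᵇ_)
open import Data.Bool.ListAction using (all; any)
open import Data.Empty using (⊥-elim)
open import Data.Fin using (Fin; zero; suc)
open import Data.Fin.Properties using (_≟_; ¬∀⟶∃¬)
open import Data.Fin.Subset
  using (Subset; inside; outside; _∈_; _∉_; _⊆_; _∩_; _∪_; _─_; _-_; ⁅_⁆; ∣_∣)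
open import Data.Fin.Subset.Properties
  using (_∈?_; _⊆?_; nonempty?; ⊆-antisym; p⊆q⇒∣p∣≤∣q∣; p⊂q⇒∣p∣<∣q∣; x∈⁅x⁆; x∈⁅y⁆⇒x≡y; x∉⁅y⁆⇒x≢y; ∪-identityʳ;
         p∩q⊆q; x∈p∩q⁺; x∈p∩q⁻; q⊆p∪q; p⊆p∪q; x∈p∪q⁻; p─q⊆p; x∈p∧x∉q⇒x∈p─q; x∈p∧x≢y⇒x∈p-y)
open import Data.List using ([]; _∷_; map; foldr; allFin)
open import Data.List.Extrema.Nat using (argmin; argmax; argmin-all; argmax-all; f[argmin]≤f[xs]; f[xs]≤f[argmax])
open import Data.List.Membership.Propositional using (lose) renaming (_∈_ to _∈ₗ_)
open import Data.List.Membership.Propositional.Properties using (∈-map⁺; ∈-++⁺ˡ; ∈-++⁺ʳ; ∈-filter⁺; ∈-allFin)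
open import Data.List.Relation.Unary.All as All using (All; _∷_)
open import Data.List.Relation.Unary.All.Properties using (all⁺; all⁻; all-filter)
open import Data.List.Relation.Unary.Any using (here; there; satisfied)
open import Data.List.Relation.Unary.Any.Properties using (any⁺; any⁻)
open import Data.Nat using (ℕ; zero; suc; _+_; _^_; _≤_; _<_; z≤n; s≤s; _⊓_; _≤?_)
open import Data.Nat.Properties
  using (≤-refl; ≤-trans; ≤-pred; <-≤-trans; n≤1+n; m⊓n≤m; m⊓n≤n; m≤m⊔n; m≤n⊔m; ⊔-lub; <⇒≱; ≰⇒>; module ≤-Reasoning)
open import Data.Product using (∃; _×_; _,_; proj₁; proj₂)
open import Data.Sum as Sum using (_⊎_; inj₁; inj₂)
open import Data.Vec using ([]; _∷_; here; there; lookup; tabulate)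
open import Data.Vec.Properties using (≡-dec; []=⇒lookup; lookup⇒[]=; lookup∘tabulate; lookup-zipWith)
open import Data.Vec.Relation.Binary.Pointwise.Extensional using (ext; Pointwise-≡⇒≡)
open import Function using (_∘_; _⇔_; mk⇔; Equivalence; case_of_)
open import Relation.Nullary using (Dec; yes; no)
open import Relation.Nullary.Decidable using (⌊_⌋; fromWitness; toWitness)
open import Relation.Binary.PropositionalEquality using (_≡_; _≢_; refl; sym; trans; subst)

open Equivalence using (to; from)

private
  variable
    n : ℕ
    x y : Fin n
    p q r : Subset n

T-not-∨ : ∀ {a b} → T (not a ∨ b) ⇔ (T a → T b)
T-not-∨ {false} = mk⇔ (λ _ ()) (λ _ → _)
T-not-∨ {true}  = mk⇔ (λ t _ → t) (λ f → f _)

T-all-allFin : ∀ {f : Fin n → Bool} → T (all f (allFin n)) ⇔ (∀ x → T (f x))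
T-all-allFin {n = n} {f = f} =
  mk⇔ (λ t x → All.lookup (all⁺ f (allFin n) t) (∈-allFin x))
      (λ h → all⁻ f {allFin n} (All.tabulate λ {x} _ → h x))

T-any-allFin : ∀ {f : Fin n → Bool} → T (any f (allFin n)) ⇔ ∃ (T ∘ f)
T-any-allFin {n = n} {f = f} =
  mk⇔ (satisfied ∘ any⁻ f (allFin n)) (λ (x , t) → any⁺ f (lose (∈-allFin x) t))

∈⇔T-lookup : x ∈ p ⇔ T (lookup p x)
∈⇔T-lookup {x = x} {p = p} =
  mk⇔ (from T-≡ ∘ []=⇒lookup) (lookup⇒[]= x p ∘ to T-≡)

∈-tabulate⇔ : ∀ {f : Fin n → Bool} → x ∈ tabulate f ⇔ T (f x)
∈-tabulate⇔ {x = x} {f = f} =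
  mk⇔ (λ x∈ → subst T (lookup∘tabulate f x) (to ∈⇔T-lookup x∈))
      (λ t → from ∈⇔T-lookup (subst T (sym (lookup∘tabulate f x)) t))

x∈p─q⇒x∉q : ∀ (p q : Subset n) → x ∈ p ─ q → x ∉ q
x∈p─q⇒x∉q (inside ∷ p) (outside ∷ q) here        ()
x∈p─q⇒x∉q (_      ∷ p) (_       ∷ q) (there x∈) (there x∈q) = x∈p─q⇒x∉q p q x∈ x∈q

x∈p-y⇒x≢y : x ∈ p - y → x ≢ y
x∈p-y⇒x≢y {p = p} {y = y} x∈ = x∉⁅y⁆⇒x≢y (x∈p─q⇒x∉q p ⁅ y ⁆ x∈)

∣p∪⁅x⁆∣≤1+∣p∣ : ∀ (p : Subset n) x → ∣ p ∪ ⁅ x ⁆ ∣ ≤ suc ∣ p ∣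
∣p∪⁅x⁆∣≤1+∣p∣ (inside  ∷ p) zero    rewrite ∪-identityʳ p = n≤1+n _
∣p∪⁅x⁆∣≤1+∣p∣ (outside ∷ p) zero    rewrite ∪-identityʳ p = ≤-refl
∣p∪⁅x⁆∣≤1+∣p∣ (inside  ∷ p) (suc x) = s≤s (∣p∪⁅x⁆∣≤1+∣p∣ p x)
∣p∪⁅x⁆∣≤1+∣p∣ (outside ∷ p) (suc x) = ∣p∪⁅x⁆∣≤1+∣p∣ p x

⊆∧∣∣≤⇒≡ : p ⊆ q → ∣ q ∣ ≤ ∣ p ∣ → p ≡ q
⊆∧∣∣≤⇒≡ {p = p} {q = q} p⊆q ∣q∣≤∣p∣ = ⊆-antisym p⊆q q⊆p
  where
  q⊆p : q ⊆ p
  q⊆p {x} x∈q with x ∈? p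
  ... | yes x∈p = x∈p
  ... | no  x∉p = ⊥-elim (<⇒≱ (p⊂q⇒∣p∣<∣q∣ (p⊆q , x , x∈q , x∉p)) ∣q∣≤∣p∣)

⊆⇒∩≡ : q ⊆ p → p ∩ q ≡ q
⊆⇒∩≡ {q = q} {p = p} q⊆p = ⊆-antisym (p∩q⊆q p q) (λ x∈q → x∈p∩q⁺ (q⊆p x∈q , x∈q))

⊆∧∉⇒∩[∪⁅⁆]≡ : q ⊆ p → x ∉ p → p ∩ (q ∪ ⁅ x ⁆) ≡ q
⊆∧∉⇒∩[∪⁅⁆]≡ {q = q} {p = p} {x = x} q⊆p x∉p =
  ⊆-antisym ∩⊆q (λ y∈q → x∈p∩q⁺ (q⊆p y∈q , p⊆p∪q ⁅ x ⁆ y∈q))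
  where
  ∩⊆q : p ∩ (q ∪ ⁅ x ⁆) ⊆ q
  ∩⊆q y∈ with x∈p∩q⁻ p _ y∈
  ... | y∈p , y∈q∪x with x∈p∪q⁻ q ⁅ x ⁆ y∈q∪x
  ...   | inj₁ y∈q = y∈q
  ...   | inj₂ y∈x = ⊥-elim (x∉p (subst (_∈ p) (x∈⁅y⁆⇒x≡y x y∈x) y∈p))

∩-≡⇒∈ : r ∩ p ≡ r ∩ q → x ∈ r → x ∈ p → x ∈ q
∩-≡⇒∈ {r = r} {p = p} {q = q} eq x∈r x∈p =
  proj₂ (x∈p∩q⁻ r q (subst (_ ∈_) eq (x∈p∩q⁺ (x∈r , x∈p))))

⊆-by-trace : p ⊆ r → (r - x) ∩ p ≡ (r - x) ∩ q → x ∈ q → p ⊆ q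
⊆-by-trace {x = x} p⊆r eq x∈q {y} y∈p with y ≟ x
... | yes refl = x∈q
... | no  y≢x  = ∩-≡⇒∈ eq (x∈p∧x≢y⇒x∈p-y (p⊆r y∈p) y≢x) y∈p

minList-≤ : ∀ {xs k} → k ∈ₗ xs → minList xs ≤ k
minList-≤ {y ∷ ys} = foldr-⊓-≤ y ys
  where
  foldr-⊓-≤ : ∀ y ys {k} → k ∈ₗ y ∷ ys → foldr _⊓_ y ys ≤ k
  foldr-⊓-≤ y []       (here refl)         = ≤-refl
  foldr-⊓-≤ y (z ∷ ys) (here refl)         = ≤-trans (m⊓n≤n z _) (foldr-⊓-≤ y ys (here refl))
  foldr-⊓-≤ y (z ∷ ys) (there (here refl)) = m⊓n≤m z _
  foldr-⊓-≤ y (z ∷ ys) (there (there k∈))  = ≤-trans (m⊓n≤n z _) (foldr-⊓-≤ y ys (there k∈))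

≤-maxList : ∀ {xs k} → k ∈ₗ xs → k ≤ maxList xs
≤-maxList {y ∷ ys} (here refl) = m≤m⊔n y (maxList ys)
≤-maxList {y ∷ ys} (there k∈)  = ≤-trans (≤-maxList k∈) (m≤n⊔m y (maxList ys))

∈-allSubsets : ∀ (p : Subset n) → p ∈ₗ allSubsets n
∈-allSubsets []                = here refl
∈-allSubsets (inside  ∷ p)     = ∈-++⁺ˡ (∈-map⁺ (inside ∷_) (∈-allSubsets p))
∈-allSubsets {suc n} (outside ∷ p) =
  ∈-++⁺ʳ (map (inside ∷_) (allSubsets n)) (∈-map⁺ (outside ∷_) (∈-allSubsets p))

Teaches : Class n → Subset n → Subset n → Set
Teaches 𝒞 C D = ∀ {C′} → T (𝒞 C′) → D ∩ C′ ≡ D ∩ C → C′ ≡ C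

Shattered : Class n → Subset n → Set
Shattered 𝒞 S = ∀ {S′} → S′ ⊆ S → ∃ λ C → T (𝒞 C) × S ∩ C ≡ S′

T-∧-not-==ᵇ : ∀ d a b → d ∧ a ≢ d ∧ b → T (d ∧ not (b ==ᵇ a))
T-∧-not-==ᵇ false _     _     ne = ne refl
T-∧-not-==ᵇ true  false false ne = ne refl
T-∧-not-==ᵇ true  false true  _  = _
T-∧-not-==ᵇ true  true  false _  = _
T-∧-not-==ᵇ true  true  true  ne = ne refl

∩≢∩⇒separated : r ∩ p ≢ r ∩ q → ∃ λ x → T (lookup r x ∧ not (lookup q x ==ᵇ lookup p x))
∩≢∩⇒separated {r = r} {p = p} {q = q} ne
  with ¬∀⟶∃¬ _ (λ x → lookup (r ∩ p) x ≡ lookup (r ∩ q) x) (λ x → _ ≟ᵇ _) (ne ∘ Pointwise-≡⇒≡ ∘ ext)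
... | x , differ = x , T-∧-not-==ᵇ (lookup r x) (lookup p x) (lookup q x) λ eq →
  differ (trans (lookup-zipWith _∧_ x r p) (trans eq (sym (lookup-zipWith _∧_ x r q))))

⊆ᵇ⇒⊆ : T (all (λ x → not (lookup p x) ∨ lookup q x) (allFin n)) → p ⊆ q
⊆ᵇ⇒⊆ p⊆ᵇq {x} x∈p = from ∈⇔T-lookup (to T-not-∨ (to T-all-allFin p⊆ᵇq x) (to ∈⇔T-lookup x∈p))

module _ (𝒞 : Class n) where

  ∈-members : T (𝒞 p) → p ∈ₗ members 𝒞
  ∈-members {p = p} p∈𝒞 = ∈-filter⁺ (λ C → 𝒞 C ≟ᵇ true) (∈-allSubsets p) (to T-≡ p∈𝒞)

  members⊆𝒞 : All (T ∘ 𝒞) (members 𝒞)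
  members⊆𝒞 = All.map (from T-≡) (all-filter (λ C → 𝒞 C ≟ᵇ true) (allSubsets n))

  TDmin≤TD : T (𝒞 p) → TDmin 𝒞 ≤ TD 𝒞 p
  TDmin≤TD p∈𝒞 = minList-≤ (∈-map⁺ (TD 𝒞) (∈-members p∈𝒞))

  TDmin≤-inhabited : ∀ {k} → (∀ {C} → T (𝒞 C) → TDmin 𝒞 ≤ k) → TDmin 𝒞 ≤ k
  TDmin≤-inhabited bound with members 𝒞 | members⊆𝒞
  ... | []    | _       = z≤n
  ... | _ ∷ _ | C∈𝒞 ∷ _ = bound C∈𝒞

  largest : T (𝒞 p) → ∃ λ M → T (𝒞 M) × (∀ {C} → T (𝒞 C) → ∣ C ∣ ≤ ∣ M ∣)
  largest {p = p} p∈𝒞 =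
    argmax ∣_∣ p (members 𝒞) ,
    argmax-all ∣_∣ p∈𝒞 members⊆𝒞 ,
    λ C∈𝒞 → All.lookup (f[xs]≤f[argmax] p (members 𝒞)) (∈-members C∈𝒞)

  smallest : T (𝒞 p) → ∃ λ M → T (𝒞 M) × (∀ {C} → T (𝒞 C) → ∣ M ∣ ≤ ∣ C ∣)
  smallest {p = p} p∈𝒞 =
    argmin ∣_∣ p (members 𝒞) ,
    argmin-all ∣_∣ p∈𝒞 members⊆𝒞 ,
    λ C∈𝒞 → All.lookup (f[argmin]≤f[xs] p (members 𝒞)) (∈-members C∈𝒞)

  TD≤∣∣ : ∀ {C D} → Teaches 𝒞 C D → TD 𝒞 C ≤ ∣ D ∣
  TD≤∣∣ {C} {D} teaches =
    minList-≤ (∈-map⁺ ∣_∣ (∈-filter⁺ (λ D → IsTeachingSet 𝒞 C D ≟ᵇ true) (∈-allSubsets D)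
                                     (to T-≡ isTeachingSet)))
    where
    separated : ∀ C′ → T (𝒞 C′) →
                T (C′ ==ˢ C ∨ any (λ x → lookup D x ∧ not (lookup C x ==ᵇ lookup C′ x)) (allFin n))
    separated C′ C′∈𝒞 with ≡-dec _≟ᵇ_ C′ C
    ... | yes _   = _
    ... | no C′≢C = from T-any-allFin (∩≢∩⇒separated (C′≢C ∘ teaches C′∈𝒞))
    isTeachingSet : T (IsTeachingSet 𝒞 C D)
    isTeachingSet = all⁻ _ {members 𝒞} (All.map (λ {C′} → separated C′) members⊆𝒞)

  ∣∣≤VCD : ∀ {S} → Shattered 𝒞 S → ∣ S ∣ ≤ VCD 𝒞
  ∣∣≤VCD {S} shattered =
    ≤-maxList (∈-map⁺ ∣_∣ (∈-filter⁺ (λ S → IsShattered 𝒞 S ≟ᵇ true) (∈-allSubsets S)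
                                     (to T-≡ isShattered)))
    where
    realised : ∀ S′ → S′ ⊆ S → T (any (λ C → (S ∩ C) ==ˢ S′) (members 𝒞))
    realised S′ S′⊆S with shattered S′⊆S
    ... | C , C∈𝒞 , S∩C≡S′ = any⁺ _ (lose (∈-members C∈𝒞) (fromWitness S∩C≡S′))
    isShattered : T (IsShattered 𝒞 S)
    isShattered = all⁻ _ {allSubsets n} (All.tabulate λ {S′} _ → from T-not-∨ (realised S′ ∘ ⊆ᵇ⇒⊆))

  largest-teaches-itself : ∀ {C} → (∀ {C′} → T (𝒞 C′) → ∣ C′ ∣ ≤ ∣ C ∣) → Teaches 𝒞 C C
  largest-teaches-itself maximal C′∈𝒞 C∩C′≡C∩C =
    sym (⊆∧∣∣≤⇒≡ (λ x∈C → ∩-≡⇒∈ (sym C∩C′≡C∩C) x∈C x∈C) (maximal C′∈𝒞))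

_⊆ᶜ_ : Class n → Class n → Set
𝒟 ⊆ᶜ 𝒞 = ∀ {C} → T (𝒟 C) → T (𝒞 C)

RTD≤ : ∀ {𝒞 : Class n} {k} → (∀ {𝒟} → 𝒟 ⊆ᶜ 𝒞 → TDmin 𝒟 ≤ k) → RTD 𝒞 ≤ k
RTD≤ {n = n} = rtdFuel≤ (2 ^ n + 1)
  where
  rtdFuel≤ : ∀ fuel {𝒞 : Class n} {k} → (∀ {𝒟} → 𝒟 ⊆ᶜ 𝒞 → TDmin 𝒟 ≤ k) → rtdFuel fuel 𝒞 ≤ k
  rtdFuel≤ zero       _ = z≤n
  rtdFuel≤ (suc fuel) {𝒞} bound with all (λ C → Cmin 𝒞 C) (members 𝒞)
  ... | true  = bound (λ t → t)
  ... | false = ⊔-lub (bound (λ t → t)) (rtdFuel≤ fuel λ 𝒟⊆ → bound (proj₁ ∘ to T-∧ ∘ 𝒟⊆))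

module _ {n} (G : SimpleGraph n) where

  N : Fin n → Subset n
  N x = tabulate (adj G x)

  x∉N[x] : x ∉ N x
  x∉N[x] {x = x} x∈N = subst T (irrefl G x) (to ∈-tabulate⇔ x∈N)

  N-sym : y ∈ N x → x ∈ N y
  N-sym {y = y} {x = x} y∈N = from ∈-tabulate⇔ (subst T (SimpleGraph.sym G x y) (to ∈-tabulate⇔ y∈N))

  ∈N∪⁅⁆⁻ : y ∈ N x ∪ ⁅ x ⁆ → y ∈ N x ⊎ y ≡ x
  ∈N∪⁅⁆⁻ {x = x} y∈ = Sum.map₂ (x∈⁅y⁆⇒x≡y x) (x∈p∪q⁻ (N x) ⁅ x ⁆ y∈)

  IsCentre : Subset n → Fin n → Set
  IsCentre S x = x ∈ S × S ⊆ N x ∪ ⁅ x ⁆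

  -- The test under `any` in Cstar, so that Cstar G S is any (centreᵇ S) (allFin n) by definition.
  centreᵇ : Subset n → Fin n → Bool
  centreᵇ S x = lookup S x ∧ all (λ y → not (lookup S y) ∨ ⌊ y ≟ x ⌋ ∨ adj G x y) (allFin n)

  T-≟∨adj : T (⌊ y ≟ x ⌋ ∨ adj G x y) ⇔ y ∈ N x ∪ ⁅ x ⁆
  T-≟∨adj {y = y} {x = x} with y ≟ x
  ... | yes refl = mk⇔ (λ _ → q⊆p∪q (N y) ⁅ y ⁆ (x∈⁅x⁆ y)) (λ _ → _)
  ... | no  y≢x  = mk⇔ (p⊆p∪q ⁅ x ⁆ ∘ from ∈-tabulate⇔)
                       (Sum.[ to ∈-tabulate⇔ , ⊥-elim ∘ y≢x ]′ ∘ ∈N∪⁅⁆⁻)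

  T-centreᵇ : ∀ {S} → T (centreᵇ S x) ⇔ IsCentre S x
  T-centreᵇ = mk⇔
    (λ t → let x∈S , S⊆ = to T-∧ t in
       from ∈⇔T-lookup x∈S ,
       λ {y} y∈S → to T-≟∨adj (to T-not-∨ (to T-all-allFin S⊆ y) (to ∈⇔T-lookup y∈S)))
    (λ (x∈S , S⊆) → from T-∧
       (to ∈⇔T-lookup x∈S ,
        from T-all-allFin λ y → from T-not-∨ λ t → from (T-≟∨adj {y = y}) (S⊆ (from ∈⇔T-lookup t))))

  T-Cstar : ∀ {S} → T (Cstar G S) ⇔ ∃ (IsCentre S)
  T-Cstar = mk⇔ (λ t → let x , c = to T-any-allFin t in x , to T-centreᵇ c)
                (λ (x , c) → from T-any-allFin (x , from T-centreᵇ c))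

  centres : Subset n → Subset n
  centres S = tabulate (centreᵇ S)

  ∈-centres⇔ : ∀ {S} → x ∈ centres S ⇔ IsCentre S x
  ∈-centres⇔ = mk⇔ (to T-centreᵇ ∘ to ∈-tabulate⇔) (from ∈-tabulate⇔ ∘ from T-centreᵇ)

  nonCentres : Subset n → Subset n
  nonCentres S = S ─ centres S

  centre-∪⁅⁆ : p ⊆ N x → IsCentre (p ∪ ⁅ x ⁆) x
  centre-∪⁅⁆ {p = p} {x = x} p⊆N =
    q⊆p∪q p ⁅ x ⁆ (x∈⁅x⁆ x) ,
    Sum.[ p⊆p∪q ⁅ x ⁆ ∘ p⊆N , q⊆p∪q (N x) ⁅ x ⁆ ]′ ∘ x∈p∪q⁻ p ⁅ x ⁆

  centre-⊆ : q ⊆ p → x ∈ q → IsCentre p x → IsCentre q x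
  centre-⊆ q⊆p x∈q (_ , p⊆) = x∈q , λ y∈q → p⊆ (q⊆p y∈q)

  centre⇒-⊆N : IsCentre p x → p - x ⊆ N x
  centre⇒-⊆N {p = p} {x = x} (_ , p⊆) y∈ with ∈N∪⁅⁆⁻ (p⊆ (p─q⊆p p ⁅ x ⁆ y∈))
  ... | inj₁ y∈N = y∈N
  ... | inj₂ y≡x = ⊥-elim (x∈p-y⇒x≢y {p = p} y∈ y≡x)

  N-shattered : Shattered (Cstar G) (N x)
  N-shattered {x = x} {S′} S′⊆N =
    S′ ∪ ⁅ x ⁆ , from T-Cstar (x , centre-∪⁅⁆ S′⊆N) , ⊆∧∉⇒∩[∪⁅⁆]≡ S′⊆N x∉N[x]

  ∣N∣≤VCD : ∣ N x ∣ ≤ VCD (Cstar G)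
  ∣N∣≤VCD = ∣∣≤VCD (Cstar G) N-shattered

  shattered-if-nonCentres⊆N : x ∉ p → nonCentres p ⊆ N x → Shattered (Cstar G) p
  shattered-if-nonCentres⊆N {x = x} {p = p} x∉p R⊆N {S′} S′⊆p with nonempty? (S′ ∩ centres p)
  ... | yes (k , k∈) =
    let k∈S′ , k-centre = x∈p∩q⁻ S′ (centres p) k∈ in
    S′ , from T-Cstar (k , centre-⊆ S′⊆p k∈S′ (to ∈-centres⇔ k-centre)) , ⊆⇒∩≡ S′⊆p
  ... | no  none =
    S′ ∪ ⁅ x ⁆ , from T-Cstar (x , centre-∪⁅⁆ λ y∈S′ → R⊆N (S′⊆R y∈S′)) , ⊆∧∉⇒∩[∪⁅⁆]≡ S′⊆p x∉p
    where
    S′⊆R : S′ ⊆ nonCentres p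
    S′⊆R {y} y∈S′ = x∈p∧x∉q⇒x∈p─q (S′⊆p y∈S′) (λ y-centre → none (y , x∈p∩q⁺ (y∈S′ , y-centre)))

  module _ {C : Subset n} (large : VCD (Cstar G) < ∣ C ∣) where

    centre-of-cover : IsCentre p x → nonCentres C ⊆ p → IsCentre C x
    centre-of-cover {p = p} {x = x} (_ , p⊆) R⊆p = x∈C , C⊆
      where
      x∈C : x ∈ C
      x∈C with x ∈? C
      ... | yes x∈C = x∈C
      ... | no  x∉C = ⊥-elim (<⇒≱ large (∣∣≤VCD (Cstar G) (shattered-if-nonCentres⊆N x∉C R⊆N)))
        where
        R⊆N : nonCentres C ⊆ N x
        R⊆N y∈R with ∈N∪⁅⁆⁻ (p⊆ (R⊆p y∈R))
        ... | inj₁ y∈N = y∈N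
        ... | inj₂ refl = ⊥-elim (x∉C (p─q⊆p C (centres C) y∈R))
      C⊆ : C ⊆ N x ∪ ⁅ x ⁆
      C⊆ {y} y∈C with y ∈? centres C
      ... | no  y-non-centre = p⊆ (R⊆p (x∈p∧x∉q⇒x∈p─q y∈C y-non-centre))
      ... | yes y-centre with ∈N∪⁅⁆⁻ (proj₂ (to ∈-centres⇔ y-centre) x∈C)
      ...   | inj₁ x∈N = p⊆p∪q ⁅ x ⁆ (N-sym x∈N)
      ...   | inj₂ refl = q⊆p∪q (N x) ⁅ x ⁆ (x∈⁅x⁆ x)

    common-centre⇒⊆ : IsCentre C x → IsCentre p x → p ⊆ C
    common-centre⇒⊆ {x = x} (_ , C⊆) (_ , p⊆) {z} z∈p with z ∈? C
    ... | yes z∈C = z∈C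
    ... | no  z∉C = ⊥-elim (<⇒≱ large (≤-trans ∣C∣≤∣N∣ ∣N∣≤VCD))
      where
      ∣C∣≤∣N∣ : ∣ C ∣ ≤ ∣ N x ∣
      ∣C∣≤∣N∣ = ≤-pred (<-≤-trans (p⊂q⇒∣p∣<∣q∣ (C⊆ , z , p⊆ z∈p , z∉C)) (∣p∪⁅x⁆∣≤1+∣p∣ (N x) x))

    module _ {𝒞 : Class n} (𝒞⊆ : 𝒞 ⊆ᶜ Cstar G) where

      smallest-cover-teaches : ∀ {M} → nonCentres C ⊆ M → IsCentre M x →
        (∀ {C′} → T (𝒞 C′) → nonCentres C ⊆ C′ → ∣ M ∣ ≤ ∣ C′ ∣) → Teaches 𝒞 M (C - x)
      smallest-cover-teaches {x = x} {M} R⊆M x-centre-M minimal {C′} C′∈𝒞 agree =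
        by-cases (x ∈? C′)
        where
        x-centre-C : IsCentre C x
        x-centre-C = centre-of-cover x-centre-M R⊆M
        M⊆C : M ⊆ C
        M⊆C = common-centre⇒⊆ x-centre-C x-centre-M
        R⊆C′ : nonCentres C ⊆ C′
        R⊆C′ {y} y∈R = ∩-≡⇒∈ (sym agree) (x∈p∧x≢y⇒x∈p-y (p─q⊆p C (centres C) y∈R) y≢x) (R⊆M y∈R)
          where
          y≢x : y ≢ x
          y≢x refl = x∈p─q⇒x∉q C (centres C) y∈R (from ∈-centres⇔ x-centre-C)
        C′⊆C : C′ ⊆ C
        C′⊆C = let x′ , x′-centre = to T-Cstar (𝒞⊆ C′∈𝒞) in
               common-centre⇒⊆ (centre-of-cover x′-centre R⊆C′) x′-centre
        C′⊆M : C′ ⊆ M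
        C′⊆M = ⊆-by-trace C′⊆C agree (proj₁ x-centre-M)
        by-cases : Dec (x ∈ C′) → C′ ≡ M
        by-cases (yes x∈C′) = ⊆-antisym C′⊆M (⊆-by-trace M⊆C (sym agree) x∈C′)
        by-cases (no  x∉C′) =
          ⊥-elim (<⇒≱ (p⊂q⇒∣p∣<∣q∣ (C′⊆M , x , proj₁ x-centre-M , x∉C′)) (minimal C′∈𝒞 R⊆C′))

      TDmin≤VCD-large : T (𝒞 C) → TDmin 𝒞 ≤ VCD (Cstar G)
      TDmin≤VCD-large C∈𝒞 =
        let M , M∈covers , minimal = smallest covers (cover C∈𝒞 (p─q⊆p C (centres C)))
            M∈𝒞 , R⊆M = to T-∧ M∈covers
            x , x-centre-M = to T-Cstar (𝒞⊆ M∈𝒞)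
        in begin
          TDmin 𝒞       ≤⟨ TDmin≤TD 𝒞 M∈𝒞 ⟩
          TD 𝒞 M        ≤⟨ TD≤∣∣ 𝒞 (smallest-cover-teaches (toWitness R⊆M) x-centre-M
                                     λ C′∈𝒞 R⊆C′ → minimal (cover C′∈𝒞 R⊆C′)) ⟩
          ∣ C - x ∣     ≤⟨ p⊆q⇒∣p∣≤∣q∣ (centre⇒-⊆N (centre-of-cover x-centre-M (toWitness R⊆M))) ⟩
          ∣ N x ∣       ≤⟨ ∣N∣≤VCD ⟩
          VCD (Cstar G) ∎
        where
        open ≤-Reasoning
        covers : Class n
        covers S = 𝒞 S ∧ ⌊ nonCentres C ⊆? S ⌋
        cover : ∀ {S} → T (𝒞 S) → nonCentres C ⊆ S → T (covers S)
        cover S∈𝒞 R⊆S = from T-∧ (S∈𝒞 , fromWitness (λ {x} → R⊆S {x}))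

  TDmin≤VCD : ∀ {𝒞} → 𝒞 ⊆ᶜ Cstar G → TDmin 𝒞 ≤ VCD (Cstar G)
  TDmin≤VCD {𝒞} 𝒞⊆ = TDmin≤-inhabited 𝒞 λ C∈𝒞 →
    let M , M∈𝒞 , maximal = largest 𝒞 C∈𝒞 in
    case ∣ M ∣ ≤? VCD (Cstar G) of λ where
      (yes small) → ≤-trans (TDmin≤TD 𝒞 M∈𝒞) (≤-trans (TD≤∣∣ 𝒞 (largest-teaches-itself 𝒞 maximal)) small)
      (no  large) → TDmin≤VCD-large (≰⇒> large) 𝒞⊆ M∈𝒞

theorem4 : (n : ℕ) (G : SimpleGraph n) → RTD (Cstar G) ≤ VCD (Cstar G)
theorem4 n G = RTD≤ (TDmin≤VCD G)
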